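{- Let $\lesssim$ be a plausible preorder on $\mathcal{T}$ and $E(\cdot|\cdot)$ the conditional expectation naturally induced by it; write $P(C|D)=E(C|D)$. Let $X$ be a random quantity and $C,D$ events. If the expression $\frac{E(X.C|D)}{E(X|C.D)}$ makes sense (numerator and denominator are defined and the quotient is defined in extended-real arithmetic), then \[P(C|D)=\frac{E(X.C|D)}{E(X|C.D)}.\]
   Context: Random quantities: $\mathcal{T}$ is a unital associative commutative algebra over $\mathbb{R}$; reals $r$ are identified with $r\mathbf{1}$; products are written $X.Y$. Events: idempotents $A$ ($A.A=A$). Plausible preorder: a relation $\lesssim$ on $\mathcal{T}$ with (i) $0\lesssim A$ for every event $A$; (ii) $0\lesssim X$ and $0\lesssim Y$ imply $0\lesssim X+Y$; (iii) $0\lesssim X$ and real $q\ge0$ imply $0\lesssim qX$; (iv) $X\lesssim Y$ iff $0\lesssim Y-X$. Strict part: $X\lnsim Y$ iff $X\lesssim Y$ and not $Y\lesssim X$. Conditional preorder: $X\lesssim_C Y$ iff $X.C\lesssim Y.C$; strict part $\lnsim_C$. Expectation induced by a plausible preorder: $E(X)$ is the real $x$ if $-\epsilon\lnsim X-x\lnsim\epsilon$ for all reals $\epsilon>0$; it is $+\infty$ if $y\lnsim X$ for all reals $y$; it is $-\infty$ if $X\lnsim y$ for all reals $y$; it is undefined otherwise. Conditional expectation: $E(X|C)$ is the expectation induced by $\lesssim_C$. Conditional probability: $P(C|D)=E(C|D)$. Extended-real division: $x/y$ is defined (with the usual value) when - $x,y$ are real and $y\neq0$; - $x$ is real and $y=\pm\infty$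 (value $0$); - $x=\pm\infty$ and $y$ is a nonzero real (value $\pm\infty$ with the usual sign rule). All other quotients, including $x/0$ and $(\pm\infty)/(\pm\infty)$, are undefined. -}

module Defs where

open import Level using (0ℓ)
open import Data.Product using (Σ; ∃; _×_; _,_)
open import Relation.Nullary using (¬_)
open import Relation.Binary.PropositionalEquality using (_≡_; _≢_)
open import Relation.Binary.Core using (Rel)
open import Relation.Binary.Structures using (IsTotalOrder)
open import Algebra.Structures using (IsCommutativeRing)

-- The real numbers, given axiomatically as a complete ordered field
-- (this characterizes ℝ up to unique isomorphism).

record RealField : Set₁ where
  infixl 6 _+_
  infixl 7 _*_
  infix  4 _≤_ _<_
  field
    R     : Set
    _+_   : R → R → R
    _*_   : R → R → R
    -_    : R → R
    0# 1# : R
    _≤_   : R → R → Set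
    isCommutativeRing : IsCommutativeRing _≡_ _+_ _*_ -_ 0# 1#
    0≢1   : 0# ≢ 1#
    inv   : (x : R) → x ≢ 0# → R
    inv-r : (x : R) (p : x ≢ 0#) → x * inv x p ≡ 1#
    isTotalOrder : IsTotalOrder _≡_ _≤_
    +-mono-≤ : ∀ {x y} z → x ≤ y → x + z ≤ y + z
    *-nonneg : ∀ {x y} → 0# ≤ x → 0# ≤ y → 0# ≤ x * y
    complete : (S : R → Set) → (Σ R S) → (Σ R λ b → ∀ x → S x → x ≤ b) →
               Σ R λ s → ((∀ x → S x → x ≤ s) ×
                          (∀ b → (∀ x → S x → x ≤ b) → s ≤ b))

  _<_ : R → R → Set
  x < y = (x ≤ y) × (x ≢ y)

data ℝ̄ (ℝ : RealField) : Set where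
  fin  : RealField.R ℝ → ℝ̄ ℝ
  +∞   : ℝ̄ ℝ
  -∞   : ℝ̄ ℝ

-- Extended-real division as a relation:  IsQuot ℝ x y q  means  "x/y is defined and equals q".
module _ (ℝ : RealField) where
  open RealField ℝ

  data IsQuot : ℝ̄ ℝ → ℝ̄ ℝ → ℝ̄ ℝ → Set where
    real/real  : (x y : R) (p : y ≢ 0#) → IsQuot (fin x) (fin y) (fin (x * inv y p))
    real/+∞    : (x : R) → IsQuot (fin x) +∞ (fin 0#)
    real/-∞    : (x : R) → IsQuot (fin x) -∞ (fin 0#)
    +∞/pos     : (y : R) → 0# < y → IsQuot +∞ (fin y) +∞
    +∞/neg     : (y : R) → y < 0# → IsQuot +∞ (fin y) -∞
    -∞/pos     : (y : R) → 0# < y → IsQuot -∞ (fin y) -∞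
    -∞/neg     : (y : R) → y < 0# → IsQuot -∞ (fin y) +∞

record RAlgebra (ℝ : RealField) : Set₁ where
  open RealField ℝ using (R) renaming (_+_ to _+ᴿ_; _*_ to _*ᴿ_; 1# to 1ᴿ)
  infixl 6 _+_
  infixl 7 _∙_
  infixr 8 _·_
  field
    T     : Set
    _+_   : T → T → T
    _∙_   : T → T → T
    -_    : T → T
    𝟘 𝟙   : T
    isCommutativeRing : IsCommutativeRing _≡_ _+_ _∙_ -_ 𝟘 𝟙
    _·_   : R → T → T
    ·-distribˡ : ∀ r X Y → r · (X + Y) ≡ r · X + r · Y
    ·-distribʳ : ∀ r s X → (r +ᴿ s) · X ≡ r · X + s · X
    ·-assoc    : ∀ r s X → (r *ᴿ s) · X ≡ r · (s · X)
    ·-identity : ∀ X → 1ᴿ · X ≡ X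
    ·-∙-assoc  : ∀ r X Y → (r · X) ∙ Y ≡ r · (X ∙ Y)

  ι : R → T
  ι r = r · 𝟙

  _-_ : T → T → T
  X - Y = X + (- Y)

  IsEvent : T → Set
  IsEvent A = A ∙ A ≡ A

module _ {ℝ : RealField} (𝒯 : RAlgebra ℝ) where
  open RealField ℝ using (R; _≤_; _<_; 0#) renaming (-_ to -ᴿ_)
  open RAlgebra 𝒯

  record IsPlausible (_≲_ : T → T → Set) : Set where
    field
      events-nonneg : ∀ A → IsEvent A → 𝟘 ≲ A
      nonneg-+      : ∀ X Y → 𝟘 ≲ X → 𝟘 ≲ Y → 𝟘 ≲ (X + Y)
      nonneg-·      : ∀ X (q : R) → 0# ≤ q → 𝟘 ≲ X → 𝟘 ≲ (q · X)
      ≲-diff        : ∀ X Y → (X ≲ Y → 𝟘 ≲ (Y - X)) × (𝟘 ≲ (Y - X) → X ≲ Y)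

  Strict : (T → T → Set) → T → T → Set
  Strict _≲_ X Y = (X ≲ Y) × ¬ (Y ≲ X)

  Cond : (T → T → Set) → T → T → T → Set
  Cond _≲_ C X Y = (X ∙ C) ≲ (Y ∙ C)

  -- IsExpectation ≲ X v :  "the expectation of X induced by ≲ is (defined and equal to) v"
  IsExpectation : (T → T → Set) → T → ℝ̄ ℝ → Set
  IsExpectation _≲_ X (fin x) =
    ∀ (ε : R) → 0# < ε →
      Strict _≲_ (ι (-ᴿ ε)) (X - ι x) × Strict _≲_ (X - ι x) (ι ε)
  IsExpectation _≲_ X +∞ = ∀ (y : R) → Strict _≲_ (ι y) X
  IsExpectation _≲_ X -∞ = ∀ (y : R) → Strict _≲_ X (ι y)

  IsCondExp : (T → T → Set) → T → T → ℝ̄ ℝ → Set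
  IsCondExp _≲_ X C v = IsExpectation (Cond _≲_ C) X v

-- Write Y ≺± W for - W ≺ Y ≺ W, and call Y negligible with respect to B if Y ≺± ε B for
-- every real ε > 0; then E(X|B) = x says exactly that (X - x) B is negligible with respect
-- to B.  Negligible quantities are closed under sums, negatives, nonzero real multiples and
-- enlarging B.  If E(XC|D) = n and E(X|CD) = m ≠ 0, then (XC - n) D and (X - m) CD are
-- negligible with respect to D (the latter because CD ≲ D for events C, D), hence so is
-- their difference m CD - n D, and multiplying by 1/m gives E(C|D) = n/m.  If instead
-- E(X|CD) = +∞ while E(XC|D) = n, then y CD ≺ XCD ≺ (n + 1) D for every real y, which
-- forces E(C|D) = 0.  A finite E(X|CD) = m rules out E(XC|D) = +∞, as XCD ≺ (m + 1) CD
-- is bounded by a real multiple of D.  The cases involving -∞ follow from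
-- E(-X|B) = -E(X|B).

module Submission where

open import Level using (0ℓ)
open import Data.Nat as ℕ using (ℕ; zero; suc; _∸_)
import Data.Nat.Properties as ℕ
open import Data.Product using (∃-syntax; _×_; _,_; proj₁; proj₂)
open import Data.Product.Properties using (≡-dec)
open import Data.Maybe using (Maybe; just; nothing)
open import Data.Sum using (_⊎_; inj₁; inj₂)
open import Data.Empty using (⊥-elim)
open import Relation.Nullary using (¬_; yes; no)
open import Relation.Binary.PropositionalEquality
  using (_≡_; _≢_; refl; sym; trans; cong; cong₂; subst; subst₂; module ≡-Reasoning)
open import Algebra.Bundles using (CommutativeRing; RawRing)
open import Relation.Binary.Structures using (IsTotalOrder)
import Algebra.Properties.Ring
open import Defs

-- Algebra.Solver.Ring with integer coefficients, which works in every commutative ring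
-- without decidable equality on the carrier.
module CommutativeRingSolver {c ℓ} (R : CommutativeRing c ℓ) where
  open CommutativeRing R
    renaming (refl to ≈-refl; sym to ≈-sym; trans to ≈-trans; reflexive to ≈-reflexive)
  open import Algebra.Properties.Ring ring
    using (-0#≈0#; -‿+-comm; -‿distribˡ-*; -‿distribʳ-*; x[y-z]≈xy-xz; ⁻¹-anti-homo‿-)
  open import Algebra.Properties.CommutativeSemigroup +-commutativeSemigroup using (interchange)
  open import Algebra.Properties.Semiring.Mult.TCOptimised semiring using (×-homo-+; ×1-homo-*) renaming (_×_ to _×′_)
  open import Algebra.Solver.Ring.AlmostCommutativeRing
    using (fromCommutativeRing; _-Raw-AlmostCommutative⟶_)
  open import Relation.Binary.Reasoning.Setoid setoid

  private
    -- The pair (m , n) codes the integer m - n.  The operations keep one entry 0,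
    -- so that equal integers have equal codes and coefficients can be compared by _≡_.
    ℤ₂ : Set
    ℤ₂ = ℕ × ℕ

    normalise : ℤ₂ → ℤ₂
    normalise (m , n) = m ∸ n , n ∸ m

    _⊕_ _⊗_ : ℤ₂ → ℤ₂ → ℤ₂
    (a , b) ⊕ (c , d) = normalise (a ℕ.+ c , b ℕ.+ d)
    (a , b) ⊗ (c , d) = normalise (a ℕ.* c ℕ.+ b ℕ.* d , a ℕ.* d ℕ.+ b ℕ.* c)

    ⊝_ : ℤ₂ → ℤ₂
    ⊝ (a , b) = b , a

    ℤ₂-rawRing : RawRing 0ℓ 0ℓ
    ℤ₂-rawRing = record
      { Carrier = ℤ₂ ; _≈_ = _≡_ ; _+_ = _⊕_ ; _*_ = _⊗_ ; -_ = ⊝_ ; 0# = 0 , 0 ; 1# = 1 , 0 }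

    diff : ℤ₂ → Carrier
    diff (m , n) = m ×′ 1# - n ×′ 1#

    -- Nonnegative coefficients are interpreted without a trailing "- 0#", so that the
    -- constants 0# and 1# in solved equations are literally 0# and 1#.
    ⟦_⟧ : ℤ₂ → Carrier
    ⟦ m , zero ⟧ = m ×′ 1#
    ⟦ m , n    ⟧ = diff (m , n)

    ⟦⟧≈diff : ∀ p → ⟦ p ⟧ ≈ diff p
    ⟦⟧≈diff (m , zero)  = ≈-sym (≈-trans (+-congˡ -0#≈0#) (+-identityʳ _))
    ⟦⟧≈diff (m , suc n) = ≈-refl

    diff-+ : ∀ a b c d → diff (a ℕ.+ c , b ℕ.+ d) ≈ diff (a , b) + diff (c , d)
    diff-+ a b c d = begin
      (a ℕ.+ c) ×′ 1# - (b ℕ.+ d) ×′ 1#                ≈⟨ +-cong (×-homo-+ 1# a c) (-‿cong (×-homo-+ 1# b d)) ⟩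
      (a ×′ 1# + c ×′ 1#) - (b ×′ 1# + d ×′ 1#)          ≈⟨ +-congˡ (-‿+-comm _ _) ⟨
      (a ×′ 1# + c ×′ 1#) + (- (b ×′ 1#) + - (d ×′ 1#))  ≈⟨ interchange _ _ _ _ ⟩
      diff (a , b) + diff (c , d)                    ∎

    diff-shift : ∀ a b k → diff (a ℕ.+ k , b ℕ.+ k) ≈ diff (a , b)
    diff-shift a b k = ≈-trans (diff-+ a b k k) (≈-trans (+-congˡ (-‿inverseʳ _)) (+-identityʳ _))

    diff-normalise : ∀ p → diff (normalise p) ≈ diff p
    diff-normalise (m , n) with ℕ.≤-total n m
    ... | inj₁ n≤m = begin
      diff (m ∸ n , n ∸ m)      ≡⟨ cong (λ k → diff (m ∸ n , k)) (ℕ.m≤n⇒m∸n≡0 n≤m) ⟩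
      diff (m ∸ n , 0)          ≈⟨ diff-shift (m ∸ n) 0 n ⟨
      diff (m ∸ n ℕ.+ n , n)    ≡⟨ cong (λ k → diff (k , n)) (ℕ.m∸n+n≡m n≤m) ⟩
      diff (m , n)              ∎
    ... | inj₂ m≤n = begin
      diff (m ∸ n , n ∸ m)      ≡⟨ cong (λ k → diff (k , n ∸ m)) (ℕ.m≤n⇒m∸n≡0 m≤n) ⟩
      diff (0 , n ∸ m)          ≈⟨ diff-shift 0 (n ∸ m) m ⟨
      diff (m , n ∸ m ℕ.+ m)    ≡⟨ cong (λ k → diff (m , k)) (ℕ.m∸n+n≡m m≤n) ⟩
      diff (m , n)              ∎

    diff-neg : ∀ a b → diff (b , a) ≈ - diff (a , b)
    diff-neg a b = ≈-sym (⁻¹-anti-homo‿- _ _)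

    diff-scale : ∀ a c d → diff (a ℕ.* c , a ℕ.* d) ≈ a ×′ 1# * diff (c , d)
    diff-scale a c d = begin
      (a ℕ.* c) ×′ 1# - (a ℕ.* d) ×′ 1#          ≈⟨ +-cong (×1-homo-* a c) (-‿cong (×1-homo-* a d)) ⟩
      a ×′ 1# * c ×′ 1# - a ×′ 1# * d ×′ 1#        ≈⟨ x[y-z]≈xy-xz _ _ _ ⟨
      a ×′ 1# * diff (c , d)                    ∎

    diff-* : ∀ a b c d → diff (a ℕ.* c ℕ.+ b ℕ.* d , a ℕ.* d ℕ.+ b ℕ.* c) ≈ diff (a , b) * diff (c , d)
    diff-* a b c d = begin
      diff (a ℕ.* c ℕ.+ b ℕ.* d , a ℕ.* d ℕ.+ b ℕ.* c)  ≈⟨ diff-+ (a ℕ.* c) (a ℕ.* d) (b ℕ.* d) (b ℕ.* c) ⟩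
      diff (a ℕ.* c , a ℕ.* d) + diff (b ℕ.* d , b ℕ.* c) ≈⟨ +-cong (diff-scale a c d) (diff-scale b d c) ⟩
      A * diff (c , d) + B * diff (d , c)                ≈⟨ +-congˡ (*-congˡ (diff-neg c d)) ⟩
      A * diff (c , d) + B * - diff (c , d)              ≈⟨ +-congˡ (≈-trans (≈-sym (-‿distribʳ-* _ _)) (-‿distribˡ-* _ _)) ⟩
      A * diff (c , d) + - B * diff (c , d)              ≈⟨ distribʳ _ _ _ ⟨
      diff (a , b) * diff (c , d)                        ∎
      where
      A B : Carrier
      A = a ×′ 1#
      B = b ×′ 1#

    ⟦⟧-+ : ∀ p q → ⟦ p ⊕ q ⟧ ≈ ⟦ p ⟧ + ⟦ q ⟧
    ⟦⟧-+ p@(a , b) q@(c , d) = begin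
      ⟦ p ⊕ q ⟧              ≈⟨ ⟦⟧≈diff (p ⊕ q) ⟩
      diff (p ⊕ q)           ≈⟨ diff-normalise (a ℕ.+ c , b ℕ.+ d) ⟩
      diff (a ℕ.+ c , b ℕ.+ d) ≈⟨ diff-+ a b c d ⟩
      diff p + diff q        ≈⟨ +-cong (⟦⟧≈diff p) (⟦⟧≈diff q) ⟨
      ⟦ p ⟧ + ⟦ q ⟧          ∎

    ⟦⟧-* : ∀ p q → ⟦ p ⊗ q ⟧ ≈ ⟦ p ⟧ * ⟦ q ⟧
    ⟦⟧-* p@(a , b) q@(c , d) = begin
      ⟦ p ⊗ q ⟧              ≈⟨ ⟦⟧≈diff (p ⊗ q) ⟩
      diff (p ⊗ q)           ≈⟨ diff-normalise (a ℕ.* c ℕ.+ b ℕ.* d , a ℕ.* d ℕ.+ b ℕ.* c) ⟩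
      diff (a ℕ.* c ℕ.+ b ℕ.* d , a ℕ.* d ℕ.+ b ℕ.* c) ≈⟨ diff-* a b c d ⟩
      diff p * diff q        ≈⟨ *-cong (⟦⟧≈diff p) (⟦⟧≈diff q) ⟨
      ⟦ p ⟧ * ⟦ q ⟧          ∎

    ⟦⟧-⊝ : ∀ p → ⟦ ⊝ p ⟧ ≈ - ⟦ p ⟧
    ⟦⟧-⊝ p@(a , b) = begin
      ⟦ ⊝ p ⟧        ≈⟨ ⟦⟧≈diff (⊝ p) ⟩
      diff (b , a)   ≈⟨ diff-neg a b ⟩
      - diff p       ≈⟨ -‿cong (⟦⟧≈diff p) ⟨
      - ⟦ p ⟧        ∎

    morphism : ℤ₂-rawRing -Raw-AlmostCommutative⟶ fromCommutativeRing R
    morphism = record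
      { ⟦_⟧ = ⟦_⟧ ; +-homo = ⟦⟧-+ ; *-homo = ⟦⟧-* ; -‿homo = ⟦⟧-⊝ ; 0-homo = ≈-refl ; 1-homo = ≈-refl }

    coefficient-equality : ∀ p q → Maybe (⟦ p ⟧ ≈ ⟦ q ⟧)
    coefficient-equality p q with ≡-dec ℕ._≟_ ℕ._≟_ p q
    ... | yes p≡q = just (≈-reflexive (cong ⟦_⟧ p≡q))
    ... | no _    = nothing

  open import Algebra.Solver.Ring ℤ₂-rawRing (fromCommutativeRing R) morphism coefficient-equality public
    using (Polynomial; con; solve; _:=_; _:+_; _:*_; :-_; _:-_)

  :0 :1 : ∀ {n} → Polynomial n
  :0 = con (0 , 0)
  :1 = con (1 , 0)

ℝ-commutativeRing : RealField → CommutativeRing 0ℓ 0ℓ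
ℝ-commutativeRing ℝ = record { isCommutativeRing = RealField.isCommutativeRing ℝ }

𝒯-commutativeRing : ∀ {ℝ} → RAlgebra ℝ → CommutativeRing 0ℓ 0ℓ
𝒯-commutativeRing 𝒯 = record { isCommutativeRing = RAlgebra.isCommutativeRing 𝒯 }

module RealFieldProperties (ℝ : RealField) where
  open RealField ℝ
  open IsTotalOrder isTotalOrder using (total; antisym) renaming (refl to ≤-refl; trans to ≤-trans)
  open CommutativeRingSolver (ℝ-commutativeRing ℝ)
    using (solve; _:=_; _:+_; _:*_; :-_; _:-_; :0; :1)
  open CommutativeRing (ℝ-commutativeRing ℝ)
    using (+-identityˡ; -‿inverseʳ; *-comm; *-assoc; *-identityˡ; *-identityʳ; zeroʳ)
  open ≡-Reasoning

  x≤0⇒0≤-x : ∀ {x} → x ≤ 0# → 0# ≤ - x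
  x≤0⇒0≤-x {x} x≤0 = subst₂ _≤_ (-‿inverseʳ x) (+-identityˡ (- x)) (+-mono-≤ (- x) x≤0)

  0≤x*x : ∀ x → 0# ≤ x * x
  0≤x*x x with total 0# x
  ... | inj₁ 0≤x = *-nonneg 0≤x 0≤x
  ... | inj₂ x≤0 = subst (0# ≤_) (solve 1 (λ x → :- x :* :- x := x :* x) refl x)
                                 (*-nonneg (x≤0⇒0≤-x x≤0) (x≤0⇒0≤-x x≤0))

  0≤1 : 0# ≤ 1#
  0≤1 = subst (0# ≤_) (*-identityʳ 1#) (0≤x*x 1#)

  0<1 : 0# < 1#
  0<1 = 0≤1 , 0≢1

  x≰0⇒0<x : ∀ {x} → ¬ (x ≤ 0#) → 0# < x
  x≰0⇒0<x {x} x≰0 with total 0# x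
  ... | inj₁ 0≤x = 0≤x , λ 0≡x → x≰0 (subst (_≤ 0#) 0≡x ≤-refl)
  ... | inj₂ x≤0 = ⊥-elim (x≰0 x≤0)

  0<1+1 : 0# < 1# + 1#
  0<1+1 = x≰0⇒0<x λ 1+1≤0 → 0≢1 (antisym 0≤1 (≤-trans 1≤1+1 1+1≤0))
    where
    1≤1+1 : 1# ≤ 1# + 1#
    1≤1+1 = subst (_≤ 1# + 1#) (+-identityˡ 1#) (+-mono-≤ 1# 0≤1)

  x≢0⇒0<x⊎0<-x : ∀ {x} → x ≢ 0# → 0# < x ⊎ 0# < - x
  x≢0⇒0<x⊎0<-x {x} x≢0 with total 0# x
  ... | inj₁ 0≤x = inj₁ (0≤x , λ 0≡x → x≢0 (sym 0≡x))
  ... | inj₂ x≤0 = inj₂ (x≤0⇒0≤-x x≤0 , λ 0≡-x → x≢0 (begin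
    x      ≡⟨ solve 1 (λ x → x := :- :- x) refl x ⟩
    - - x  ≡⟨ cong -_ (sym 0≡-x) ⟩
    - 0#   ≡⟨ solve 0 (:- :0 := :0) refl ⟩
    0#     ∎))

  pos⇒≢0 : ∀ {x} → 0# < x → x ≢ 0#
  pos⇒≢0 (_ , 0≢x) x≡0 = 0≢x (sym x≡0)

  x⁻¹*x≡1 : ∀ {x} (x≢0 : x ≢ 0#) → inv x x≢0 * x ≡ 1#
  x⁻¹*x≡1 {x} x≢0 = trans (*-comm (inv x x≢0) x) (inv-r x x≢0)

  [x*y⁻¹]*y≡x : ∀ x {y} (y≢0 : y ≢ 0#) → (x * inv y y≢0) * y ≡ x
  [x*y⁻¹]*y≡x x {y} y≢0 = begin
    (x * inv y y≢0) * y  ≡⟨ *-assoc x _ y ⟩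
    x * (inv y y≢0 * y)  ≡⟨ cong (x *_) (x⁻¹*x≡1 y≢0) ⟩
    x * 1#               ≡⟨ *-identityʳ x ⟩
    x                    ∎

  x*[y*x⁻¹]≡y : ∀ {x} y (x≢0 : x ≢ 0#) → x * (y * inv x x≢0) ≡ y
  x*[y*x⁻¹]≡y {x} y x≢0 = trans (*-comm x _) ([x*y⁻¹]*y≡x y x≢0)

  inv-≢0 : ∀ {x} (x≢0 : x ≢ 0#) → inv x x≢0 ≢ 0#
  inv-≢0 {x} x≢0 x⁻¹≡0 = 0≢1 (begin
    0#             ≡⟨ sym (zeroʳ x) ⟩
    x * 0#         ≡⟨ cong (x *_) (sym x⁻¹≡0) ⟩
    x * inv x x≢0  ≡⟨ inv-r x x≢0 ⟩
    1#             ∎)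

  *-pos : ∀ {x y} → 0# < x → 0# < y → 0# < x * y
  *-pos {x} {y} 0<x 0<y = *-nonneg (proj₁ 0<x) (proj₁ 0<y) , λ 0≡xy → pos⇒≢0 0<y (begin
    y                   ≡⟨ sym (*-identityˡ y) ⟩
    1# * y              ≡⟨ cong (_* y) (sym (x⁻¹*x≡1 x≢0)) ⟩
    (inv x x≢0 * x) * y ≡⟨ *-assoc _ x y ⟩
    inv x x≢0 * (x * y) ≡⟨ cong (inv x x≢0 *_) (sym 0≡xy) ⟩
    inv x x≢0 * 0#      ≡⟨ zeroʳ _ ⟩
    0#                  ∎)
    where
    x≢0 : x ≢ 0#
    x≢0 = pos⇒≢0 0<x

  -- x⁻¹ = x (x⁻¹)² is nonnegative together with x.
  inv-pos : ∀ {x} (0<x : 0# < x) → 0# < inv x (pos⇒≢0 0<x)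
  inv-pos {x} 0<x = subst (0# ≤_) x*x⁻²≡x⁻¹ (*-nonneg (proj₁ 0<x) (0≤x*x x⁻¹)) , λ 0≡x⁻¹ → inv-≢0 x≢0 (sym 0≡x⁻¹)
    where
    x≢0 : x ≢ 0#
    x≢0 = pos⇒≢0 0<x
    x⁻¹ : R
    x⁻¹ = inv x x≢0
    x*x⁻²≡x⁻¹ : x * (x⁻¹ * x⁻¹) ≡ x⁻¹
    x*x⁻²≡x⁻¹ = trans (sym (*-assoc x x⁻¹ x⁻¹)) (trans (cong (_* x⁻¹) (inv-r x x≢0)) (*-identityˡ x⁻¹))

  half : R → R
  half x = x * inv (1# + 1#) (pos⇒≢0 0<1+1)

  half-pos : ∀ {x} → 0# < x → 0# < half x
  half-pos 0<x = *-pos 0<x (inv-pos 0<1+1)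

  half+half : ∀ x → half x + half x ≡ x
  half+half x = begin
    half x + half x       ≡⟨ solve 1 (λ h → h :+ h := h :* (:1 :+ :1)) refl (half x) ⟩
    half x * (1# + 1#)    ≡⟨ [x*y⁻¹]*y≡x x (pos⇒≢0 0<1+1) ⟩
    x                     ∎

  -ℝ̄_ : ℝ̄ ℝ → ℝ̄ ℝ
  -ℝ̄ fin x = fin (- x)
  -ℝ̄ +∞    = -∞
  -ℝ̄ -∞    = +∞

module RAlgebraProperties {ℝ : RealField} (𝒯 : RAlgebra ℝ) where
  open RealField ℝ using (0#; 1#) renaming (_+_ to _+ᴿ_; _*_ to _*ᴿ_; -_ to -ᴿ_)
  open RAlgebra 𝒯
  open CommutativeRingSolver (𝒯-commutativeRing 𝒯)
    using (solve; _:=_; _:+_; _:*_; :-_; _:-_; :0; :1)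
  private
    module ℝ = CommutativeRing (ℝ-commutativeRing ℝ)
    module ℝ-properties = Algebra.Properties.Ring ℝ.ring
  open CommutativeRing (𝒯-commutativeRing 𝒯) using (*-identityˡ; *-assoc; distribʳ; zeroʳ)
  open import Algebra.Properties.Ring (CommutativeRing.ring (𝒯-commutativeRing 𝒯))
    using (+-identityˡ-unique; +-inverseˡ-unique)
  open import Algebra.Properties.Ring (CommutativeRing.ring (𝒯-commutativeRing 𝒯))
    using (-‿distribˡ-*) public
  open ≡-Reasoning

  ·≡ι∙ : ∀ r Y → r · Y ≡ ι r ∙ Y
  ·≡ι∙ r Y = begin
    r · Y        ≡⟨ cong (r ·_) (sym (*-identityˡ Y)) ⟩
    r · (𝟙 ∙ Y)  ≡⟨ sym (·-∙-assoc r 𝟙 Y) ⟩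
    ι r ∙ Y      ∎

  ι-+ : ∀ a b → ι (a +ᴿ b) ≡ ι a + ι b
  ι-+ a b = ·-distribʳ a b 𝟙

  ι-* : ∀ a b → ι (a *ᴿ b) ≡ ι a ∙ ι b
  ι-* a b = trans (·-assoc a b 𝟙) (·≡ι∙ a (ι b))

  ι-1 : ι 1# ≡ 𝟙
  ι-1 = ·-identity 𝟙

  ι-0 : ι 0# ≡ 𝟘
  ι-0 = +-identityˡ-unique (ι 0#) (ι 0#) (trans (sym (ι-+ 0# 0#)) (cong ι (ℝ.+-identityˡ 0#)))

  ι-neg : ∀ a → ι (-ᴿ a) ≡ - ι a
  ι-neg a = +-inverseˡ-unique (ι (-ᴿ a)) (ι a) (trans (sym (ι-+ (-ᴿ a) a)) (trans (cong ι (ℝ.-‿inverseˡ a)) ι-0))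

  ι∙ι∙ : ∀ a b Y → ι a ∙ (ι b ∙ Y) ≡ ι (a *ᴿ b) ∙ Y
  ι∙ι∙ a b Y = trans (sym (*-assoc (ι a) (ι b) Y)) (cong (_∙ Y) (sym (ι-* a b)))

  ι∙+ι∙ : ∀ a b Y → ι a ∙ Y + ι b ∙ Y ≡ ι (a +ᴿ b) ∙ Y
  ι∙+ι∙ a b Y = trans (sym (distribʳ Y (ι a) (ι b))) (cong (_∙ Y) (sym (ι-+ a b)))

  neg-ι∙ : ∀ a Y → - (ι a ∙ Y) ≡ ι (-ᴿ a) ∙ Y
  neg-ι∙ a Y = trans (-‿distribˡ-* (ι a) Y) (cong (_∙ Y) (sym (ι-neg a)))

  neg-ι∙-neg : ∀ a Y → - (ι (-ᴿ a) ∙ Y) ≡ ι a ∙ Y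
  neg-ι∙-neg a Y = trans (neg-ι∙ (-ᴿ a) Y) (cong (λ r → ι r ∙ Y) (ℝ-properties.-‿involutive a))

  ι0∙ : ∀ Y → ι 0# ∙ Y ≡ 𝟘
  ι0∙ Y = trans (cong (_∙ Y) ι-0) (solve 1 (λ y → :0 :* y := :0) refl Y)

  ι∙𝟘≡ι0∙ : ∀ a Y → ι a ∙ 𝟘 ≡ ι 0# ∙ Y
  ι∙𝟘≡ι0∙ a Y = trans (zeroʳ (ι a)) (sym (ι0∙ Y))

  ι1∙ : ∀ Y → ι 1# ∙ Y ≡ Y
  ι1∙ Y = trans (cong (_∙ Y) ι-1) (*-identityˡ Y)

  𝟘-event : IsEvent 𝟘
  𝟘-event = zeroʳ 𝟘

  ∙-event : ∀ {A B} → IsEvent A → IsEvent B → IsEvent (A ∙ B)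
  ∙-event {A} {B} AA≡A BB≡B = begin
    (A ∙ B) ∙ (A ∙ B)  ≡⟨ solve 2 (λ a b → (a :* b) :* (a :* b) := (a :* a) :* (b :* b)) refl A B ⟩
    (A ∙ A) ∙ (B ∙ B)  ≡⟨ cong₂ _∙_ AA≡A BB≡B ⟩
    A ∙ B              ∎

  complement-event : ∀ {A} → IsEvent A → IsEvent (𝟙 - A)
  complement-event {A} AA≡A = begin
    (𝟙 - A) ∙ (𝟙 - A)        ≡⟨ solve 1 (λ a → (:1 :- a) :* (:1 :- a) := (:1 :- a) :+ (a :* a :- a)) refl A ⟩
    (𝟙 - A) + ((A ∙ A) - A)  ≡⟨ cong (λ Z → (𝟙 - A) + (Z - A)) AA≡A ⟩
    (𝟙 - A) + (A - A)        ≡⟨ solve 1 (λ a → (:1 :- a) :+ (a :- a) := :1 :- a) refl A ⟩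
    𝟙 - A                    ∎

module PlausiblePreorderProperties
  {ℝ : RealField} {𝒯 : RAlgebra ℝ} {_≲_ : RAlgebra.T 𝒯 → RAlgebra.T 𝒯 → Set}
  (plausible : IsPlausible 𝒯 _≲_) where

  open RealField ℝ using (R; 0#; 1#; _≤_; _<_; inv) renaming (_+_ to _+ᴿ_; _*_ to _*ᴿ_; -_ to -ᴿ_)
  open IsTotalOrder (RealField.isTotalOrder ℝ) using (total)
  open RealFieldProperties ℝ
  open RAlgebra 𝒯
  open RAlgebraProperties 𝒯
  open IsPlausible plausible
  open CommutativeRingSolver (𝒯-commutativeRing 𝒯)
    using (solve; _:=_; _:+_; _:*_; :-_; _:-_; :0)

  infix 4 _≺_ _≺±_

  _≺_ : T → T → Set
  _≺_ = Strict 𝒯 _≲_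

  ≲⇒0≲- : ∀ {X Y} → X ≲ Y → 𝟘 ≲ (Y - X)
  ≲⇒0≲- {X} {Y} = proj₁ (≲-diff X Y)

  0≲-⇒≲ : ∀ {X Y} → 𝟘 ≲ (Y - X) → X ≲ Y
  0≲-⇒≲ {X} {Y} = proj₂ (≲-diff X Y)

  ≲-refl : ∀ {X} → X ≲ X
  ≲-refl {X} = 0≲-⇒≲ (subst (𝟘 ≲_) (solve 1 (λ x → :0 := x :- x) refl X) (events-nonneg 𝟘 𝟘-event))

  ≲-trans : ∀ {X Y Z} → X ≲ Y → Y ≲ Z → X ≲ Z
  ≲-trans {X} {Y} {Z} X≲Y Y≲Z =
    0≲-⇒≲ (subst (𝟘 ≲_) (solve 3 (λ x y z → (z :- y) :+ (y :- x) := z :- x) refl X Y Z)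
                        (nonneg-+ _ _ (≲⇒0≲- Y≲Z) (≲⇒0≲- X≲Y)))

  +-mono-≲ : ∀ {X Y U V} → X ≲ Y → U ≲ V → (X + U) ≲ (Y + V)
  +-mono-≲ {X} {Y} {U} {V} X≲Y U≲V =
    0≲-⇒≲ (subst (𝟘 ≲_) (solve 4 (λ x y u v → (y :- x) :+ (v :- u) := (y :+ v) :- (x :+ u)) refl X Y U V)
                        (nonneg-+ _ _ (≲⇒0≲- X≲Y) (≲⇒0≲- U≲V)))

  neg-antimono-≲ : ∀ {X Y} → X ≲ Y → (- Y) ≲ (- X)
  neg-antimono-≲ {X} {Y} X≲Y =
    0≲-⇒≲ (subst (𝟘 ≲_) (solve 2 (λ x y → y :- x := (:- x) :- (:- y)) refl X Y) (≲⇒0≲- X≲Y))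

  ι∙-mono-≲ : ∀ {r X Y} → 0# ≤ r → X ≲ Y → (ι r ∙ X) ≲ (ι r ∙ Y)
  ι∙-mono-≲ {r} {X} {Y} 0≤r X≲Y =
    0≲-⇒≲ (subst (𝟘 ≲_) r·[Y-X]≡rY-rX (nonneg-· (Y - X) r 0≤r (≲⇒0≲- X≲Y)))
    where
    r·[Y-X]≡rY-rX : r · (Y - X) ≡ (ι r ∙ Y) - (ι r ∙ X)
    r·[Y-X]≡rY-rX = trans (·≡ι∙ r (Y - X)) (solve 3 (λ k x y → k :* (y :- x) := k :* y :- k :* x) refl (ι r) X Y)

  ι∙-antimono-≲ : ∀ {r X Y} → r ≤ 0# → X ≲ Y → (ι r ∙ Y) ≲ (ι r ∙ X)
  ι∙-antimono-≲ {r} {X} {Y} r≤0 X≲Y =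
    subst₂ _≲_ (neg-ι∙-neg r Y) (neg-ι∙-neg r X) (neg-antimono-≲ (ι∙-mono-≲ (x≤0⇒0≤-x r≤0) X≲Y))

  ι∙-cancel-≲ : ∀ {r X Y} → 0# < r → (ι r ∙ X) ≲ (ι r ∙ Y) → X ≲ Y
  ι∙-cancel-≲ {r} {X} {Y} 0<r rX≲rY = subst₂ _≲_ (cancel X) (cancel Y) (ι∙-mono-≲ (proj₁ (inv-pos 0<r)) rX≲rY)
    where
    cancel : ∀ Z → ι (inv r (pos⇒≢0 0<r)) ∙ (ι r ∙ Z) ≡ Z
    cancel Z = trans (ι∙ι∙ _ r Z) (trans (cong (λ s → ι s ∙ Z) (x⁻¹*x≡1 (pos⇒≢0 0<r))) (ι1∙ Z))

  ≺-≲-trans : ∀ {X Y Z} → X ≺ Y → Y ≲ Z → X ≺ Z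
  ≺-≲-trans (X≲Y , Y≴X) Y≲Z = ≲-trans X≲Y Y≲Z , λ Z≲X → Y≴X (≲-trans Y≲Z Z≲X)

  ≲-≺-trans : ∀ {X Y Z} → X ≲ Y → Y ≺ Z → X ≺ Z
  ≲-≺-trans X≲Y (Y≲Z , Z≴Y) = ≲-trans X≲Y Y≲Z , λ Z≲X → Z≴Y (≲-trans Z≲X X≲Y)

  +-mono-≺-≲ : ∀ {X Y U V} → X ≺ Y → U ≲ V → X + U ≺ Y + V
  +-mono-≺-≲ {X} {Y} {U} {V} (X≲Y , Y≴X) U≲V =
    +-mono-≲ X≲Y U≲V ,
    λ Y+V≲X+U → Y≴X (subst₂ _≲_ (cancel Y V) (cancel X U) (+-mono-≲ Y+V≲X+U (neg-antimono-≲ U≲V)))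
    where
    cancel : ∀ A B → (A + B) + - B ≡ A
    cancel = solve 2 (λ a b → (a :+ b) :+ :- b := a) refl

  neg-antimono-≺ : ∀ {X Y} → X ≺ Y → - Y ≺ - X
  neg-antimono-≺ {X} {Y} (X≲Y , Y≴X) =
    neg-antimono-≲ X≲Y , λ -X≲-Y → Y≴X (subst₂ _≲_ (neg-neg Y) (neg-neg X) (neg-antimono-≲ -X≲-Y))
    where
    neg-neg : ∀ A → - - A ≡ A
    neg-neg = solve 1 (λ a → :- :- a := a) refl

  ι∙-mono-≺ : ∀ {r X Y} → 0# < r → X ≺ Y → ι r ∙ X ≺ ι r ∙ Y
  ι∙-mono-≺ 0<r (X≲Y , Y≴X) = ι∙-mono-≲ (proj₁ 0<r) X≲Y , λ rY≲rX → Y≴X (ι∙-cancel-≲ 0<r rY≲rX)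

  ι∙-cancel-≺ : ∀ {r X Y} → 0# < r → ι r ∙ X ≺ ι r ∙ Y → X ≺ Y
  ι∙-cancel-≺ 0<r (rX≲rY , rY≴rX) = ι∙-cancel-≲ 0<r rX≲rY , λ Y≲X → rY≴rX (ι∙-mono-≲ (proj₁ 0<r) Y≲X)

  ι∙-dominated : ∀ {A B} → 𝟘 ≲ A → A ≲ B → ∀ r → ∃[ s ] (ι r ∙ A) ≲ (ι s ∙ B)
  ι∙-dominated {A} {B} 0≲A A≲B r with total 0# r
  ... | inj₁ 0≤r = r , ι∙-mono-≲ 0≤r A≲B
  ... | inj₂ r≤0 = 0# , subst ((ι r ∙ A) ≲_) (ι∙𝟘≡ι0∙ r B) (ι∙-antimono-≲ r≤0 0≲A)

  _≺±_ : T → T → Set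
  Y ≺± W = (- W ≺ Y) × (Y ≺ W)

  ≺±-neg : ∀ {Y W} → Y ≺± W → - Y ≺± W
  ≺±-neg {Y} {W} (-W≺Y , Y≺W) = neg-antimono-≺ Y≺W , subst (- Y ≺_) (solve 1 (λ w → :- :- w := w) refl W) (neg-antimono-≺ -W≺Y)

  ≺±-+ : ∀ {Y Y′ W W′} → Y ≺± W → Y′ ≺± W′ → Y + Y′ ≺± W + W′
  ≺±-+ {W = W} {W′} (-W≺Y , Y≺W) (-W′≺Y′ , Y′≺W′) =
    subst (_≺ _) (solve 2 (λ w w′ → :- w :+ :- w′ := :- (w :+ w′)) refl W W′) (+-mono-≺-≲ -W≺Y (proj₁ -W′≺Y′)) ,
    +-mono-≺-≲ Y≺W (proj₁ Y′≺W′)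

  ≺±-≲-trans : ∀ {Y W W′} → Y ≺± W → W ≲ W′ → Y ≺± W′
  ≺±-≲-trans (-W≺Y , Y≺W) W≲W′ = ≲-≺-trans (neg-antimono-≲ W≲W′) -W≺Y , ≺-≲-trans Y≺W W≲W′

  ι∙-mono-≺± : ∀ {r Y W} → 0# < r → Y ≺± W → ι r ∙ Y ≺± ι r ∙ W
  ι∙-mono-≺± {r} {Y} {W} 0<r (-W≺Y , Y≺W) =
    subst (_≺ ι r ∙ Y) (solve 2 (λ k w → k :* :- w := :- (k :* w)) refl (ι r) W) (ι∙-mono-≺ 0<r -W≺Y) ,
    ι∙-mono-≺ 0<r Y≺W

  nonneg-≺⇒≺± : ∀ {Y W} → 𝟘 ≲ Y → Y ≺ W → Y ≺± W
  nonneg-≺⇒≺± {Y} {W} 0≲Y Y≺W =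
    ≺-≲-trans (subst (- W ≺_) (solve 0 (:- :0 := :0) refl) (neg-antimono-≺ (≲-≺-trans 0≲Y Y≺W))) 0≲Y , Y≺W

  Negligible : T → T → Set
  Negligible Y B = ∀ ε → 0# < ε → Y ≺± ι ε ∙ B

  negligible-neg : ∀ {Y B} → Negligible Y B → Negligible (- Y) B
  negligible-neg N ε 0<ε = ≺±-neg (N ε 0<ε)

  negligible-+ : ∀ {U V B} → Negligible U B → Negligible V B → Negligible (U + V) B
  negligible-+ {U} {V} {B} NU NV ε 0<ε =
    subst (U + V ≺±_) (trans (ι∙+ι∙ (half ε) (half ε) B) (cong (λ r → ι r ∙ B) (half+half ε)))
          (≺±-+ (NU (half ε) (half-pos 0<ε)) (NV (half ε) (half-pos 0<ε)))

  negligible-≲ : ∀ {Y A B} → A ≲ B → Negligible Y A → Negligible Y B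
  negligible-≲ A≲B N ε 0<ε = ≺±-≲-trans (N ε 0<ε) (ι∙-mono-≲ (proj₁ 0<ε) A≲B)

  negligible-ι∙-pos : ∀ {r Y B} → 0# < r → Negligible Y B → Negligible (ι r ∙ Y) B
  negligible-ι∙-pos {r} {Y} {B} 0<r N ε 0<ε =
    subst (ι r ∙ Y ≺±_) (trans (ι∙ι∙ r _ B) (cong (λ t → ι t ∙ B) (x*[y*x⁻¹]≡y ε (pos⇒≢0 0<r))))
          (ι∙-mono-≺± 0<r (N (ε *ᴿ inv r (pos⇒≢0 0<r)) (*-pos 0<ε (inv-pos 0<r))))

  negligible-ι∙ : ∀ {r Y B} → r ≢ 0# → Negligible Y B → Negligible (ι r ∙ Y) B
  negligible-ι∙ {r} {Y} {B} r≢0 N with x≢0⇒0<x⊎0<-x r≢0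
  ... | inj₁ 0<r  = negligible-ι∙-pos 0<r N
  ... | inj₂ 0<-r = subst (λ Z → Negligible Z B) -r∙-Y≡r∙Y (negligible-ι∙-pos 0<-r (negligible-neg N))
    where
    -r∙-Y≡r∙Y : ι (-ᴿ r) ∙ (- Y) ≡ ι r ∙ Y
    -r∙-Y≡r∙Y = trans (cong (_∙ - Y) (ι-neg r)) (solve 2 (λ k y → :- k :* :- y := k :* y) refl (ι r) Y)

  -- With y = 0 the bound forces k > 0; with y = k/ε it gives A ≺ ε B after cancelling k/ε.
  negligible-if-multiples-bounded : ∀ {A B k} → 𝟘 ≲ A → 𝟘 ≲ B → (∀ y → ι y ∙ A ≺ ι k ∙ B) → Negligible A B
  negligible-if-multiples-bounded {A} {B} {k} 0≲A 0≲B bound ε 0<ε =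
    nonneg-≺⇒≺± 0≲A (ι∙-cancel-≺ 0<k/ε (subst (ι k/ε ∙ A ≺_) kB≡k/ε∙εB (bound k/ε)))
    where
    k≰0 : ¬ (k ≤ 0#)
    k≰0 k≤0 = proj₂ (bound 0#) (subst ((ι k ∙ B) ≲_) (ι∙𝟘≡ι0∙ k A) (ι∙-antimono-≲ k≤0 0≲B))
    k/ε : R
    k/ε = k *ᴿ inv ε (pos⇒≢0 0<ε)
    0<k/ε : 0# < k/ε
    0<k/ε = *-pos (x≰0⇒0<x k≰0) (inv-pos 0<ε)
    kB≡k/ε∙εB : ι k ∙ B ≡ ι k/ε ∙ (ι ε ∙ B)
    kB≡k/ε∙εB = sym (trans (ι∙ι∙ k/ε ε B) (cong (λ t → ι t ∙ B) ([x*y⁻¹]*y≡x k (pos⇒≢0 0<ε))))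

  E[_∣_]≡_ : T → T → ℝ̄ ℝ → Set
  E[ X ∣ B ]≡ v = IsCondExp 𝒯 _≲_ X B v

  condExp-fin⇒negligible : ∀ {X B x} → E[ X ∣ B ]≡ fin x → Negligible ((X - ι x) ∙ B) B
  condExp-fin⇒negligible {X} {B} {x} E ε 0<ε =
    subst (_≺ (X - ι x) ∙ B) (sym (neg-ι∙ ε B)) (proj₁ (E ε 0<ε)) , proj₂ (E ε 0<ε)

  negligible⇒condExp-fin : ∀ {X B x} → Negligible ((X - ι x) ∙ B) B → E[ X ∣ B ]≡ fin x
  negligible⇒condExp-fin {X} {B} {x} N ε 0<ε =
    subst (_≺ (X - ι x) ∙ B) (neg-ι∙ ε B) (proj₁ (N ε 0<ε)) , proj₂ (N ε 0<ε)

  condExp-fin-upper : ∀ {X B x} → E[ X ∣ B ]≡ fin x → X ∙ B ≺ ι (1# +ᴿ x) ∙ B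
  condExp-fin-upper {X} {B} {x} E =
    subst₂ _≺_ (solve 3 (λ y a b → (y :- a) :* b :+ a :* b := y :* b) refl X (ι x) B) (ι∙+ι∙ 1# x B)
               (+-mono-≺-≲ (proj₂ (E 1# 0<1)) (≲-refl {ι x ∙ B}))

  condExp-neg : ∀ {X B} v → E[ X ∣ B ]≡ v → E[ - X ∣ B ]≡ (-ℝ̄ v)
  condExp-neg {X} {B} (fin x) E =
    negligible⇒condExp-fin (subst (λ Z → Negligible Z B) -[X-x]B≡[-X+x]B (negligible-neg (condExp-fin⇒negligible E)))
    where
    -[X-x]B≡[-X+x]B : - ((X - ι x) ∙ B) ≡ ((- X) - ι (-ᴿ x)) ∙ B
    -[X-x]B≡[-X+x]B = trans (solve 3 (λ y a b → :- ((y :- a) :* b) := (:- y :- :- a) :* b) refl X (ι x) B)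
                            (cong (λ a → ((- X) - a) ∙ B) (sym (ι-neg x)))
  condExp-neg {X} {B} +∞ E y =
    subst₂ _≺_ (-‿distribˡ-* X B) (neg-ι∙-neg y B) (neg-antimono-≺ (E (-ᴿ y)))
  condExp-neg {X} {B} -∞ E y =
    subst₂ _≺_ (neg-ι∙-neg y B) (-‿distribˡ-* X B) (neg-antimono-≺ (E (-ᴿ y)))

module QuotientRule
  {ℝ : RealField} {𝒯 : RAlgebra ℝ} {_≲_ : RAlgebra.T 𝒯 → RAlgebra.T 𝒯 → Set}
  (plausible : IsPlausible 𝒯 _≲_) {C D : RAlgebra.T 𝒯}
  (C-event : RAlgebra.IsEvent 𝒯 C) (D-event : RAlgebra.IsEvent 𝒯 D) where

  open RealField ℝ using (R; 0#; 1#; inv) renaming (_+_ to _+ᴿ_; _*_ to _*ᴿ_)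
  open RealFieldProperties ℝ
  open RAlgebra 𝒯
  open RAlgebraProperties 𝒯
  open IsPlausible plausible
  open PlausiblePreorderProperties plausible
  open CommutativeRingSolver (𝒯-commutativeRing 𝒯)
    using (solve; _:=_; _:+_; _:*_; :-_; _:-_; :0; :1)
  open ≡-Reasoning
  private module ℝ = CommutativeRing (ℝ-commutativeRing ℝ)

  0≲CD : 𝟘 ≲ (C ∙ D)
  0≲CD = events-nonneg _ (∙-event C-event D-event)

  CD≲D : (C ∙ D) ≲ D
  CD≲D = 0≲-⇒≲ (subst (𝟘 ≲_) (solve 2 (λ c d → (:1 :- c) :* d := d :- c :* d) refl C D)
                               (events-nonneg _ (∙-event (complement-event C-event) D-event)))

  XC∙D≡X∙CD : ∀ X → (X ∙ C) ∙ D ≡ X ∙ (C ∙ D)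
  XC∙D≡X∙CD X = solve 3 (λ x c d → (x :* c) :* d := x :* (c :* d)) refl X C D

  +∞-numerator-impossible : ∀ X {m} → E[ X ∙ C ∣ D ]≡ +∞ → ¬ E[ X ∣ C ∙ D ]≡ fin m
  +∞-numerator-impossible X {m} E[XC∣D] E[X∣CD] with ι∙-dominated 0≲CD CD≲D (1# +ᴿ m)
  ... | s , kCD≲sD = proj₂ (E[XC∣D] s)
    (subst (_≲ (ι s ∙ D)) (sym (XC∙D≡X∙CD X)) (≲-trans (proj₁ (condExp-fin-upper E[X∣CD])) kCD≲sD))

  +∞-denominator⇒zero : ∀ X {n} → E[ X ∙ C ∣ D ]≡ fin n → E[ X ∣ C ∙ D ]≡ +∞ → E[ C ∣ D ]≡ fin 0#
  +∞-denominator⇒zero X {n} E[XC∣D] E[X∣CD] =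
    negligible⇒condExp-fin (subst (λ Z → Negligible Z D) CD≡[C-0]D
      (negligible-if-multiples-bounded 0≲CD (events-nonneg D D-event) bound))
    where
    bound : ∀ y → ι y ∙ (C ∙ D) ≺ ι (1# +ᴿ n) ∙ D
    bound y = ≺-≲-trans (E[X∣CD] y) (subst (_≲ (ι (1# +ᴿ n) ∙ D)) (XC∙D≡X∙CD X) (proj₁ (condExp-fin-upper E[XC∣D])))
    CD≡[C-0]D : C ∙ D ≡ (C - ι 0#) ∙ D
    CD≡[C-0]D = trans (solve 2 (λ c d → c :* d := (c :- :0) :* d) refl C D) (cong (λ a → (C - a) ∙ D) (sym ι-0))

  finite-quotient : ∀ X {n m} → E[ X ∙ C ∣ D ]≡ fin n → E[ X ∣ C ∙ D ]≡ fin m →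
                    (m≢0 : m ≢ 0#) → E[ C ∣ D ]≡ fin (n *ᴿ inv m m≢0)
  finite-quotient X {n} {m} E[XC∣D] E[X∣CD] m≢0 =
    negligible⇒condExp-fin (subst (λ Z → Negligible Z D) m⁻¹[mCD-nD]≡[C-n/m]D
      (negligible-ι∙ (inv-≢0 m≢0) (negligible-+ (condExp-fin⇒negligible E[XC∣D])
        (negligible-neg (negligible-≲ CD≲D (condExp-fin⇒negligible E[X∣CD]))))))
    where
    m⁻¹ : R
    m⁻¹ = inv m m≢0
    m⁻¹[mCD-nD]≡[C-n/m]D : ι m⁻¹ ∙ (((X ∙ C) - ι n) ∙ D + - ((X - ι m) ∙ (C ∙ D))) ≡ (C - ι (n *ᴿ m⁻¹)) ∙ D
    m⁻¹[mCD-nD]≡[C-n/m]D = begin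
      ι m⁻¹ ∙ (((X ∙ C) - ι n) ∙ D + - ((X - ι m) ∙ (C ∙ D)))
        ≡⟨ solve 6 (λ i a b x c d → i :* (((x :* c) :- a) :* d :+ :- ((x :- b) :* (c :* d)))
                                    := (i :* b) :* (c :* d) :- (i :* a) :* d) refl (ι m⁻¹) (ι n) (ι m) X C D ⟩
      ((ι m⁻¹ ∙ ι m) ∙ (C ∙ D)) - ((ι m⁻¹ ∙ ι n) ∙ D)
        ≡⟨ cong₂ (λ u v → (u ∙ (C ∙ D)) - (v ∙ D)) m⁻¹m≡1 m⁻¹n≡n/m ⟩
      (𝟙 ∙ (C ∙ D)) - (ι (n *ᴿ m⁻¹) ∙ D)
        ≡⟨ solve 3 (λ c d a → :1 :* (c :* d) :- a :* d := (c :- a) :* d) refl C D (ι (n *ᴿ m⁻¹)) ⟩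
      (C - ι (n *ᴿ m⁻¹)) ∙ D ∎
      where
      m⁻¹m≡1 : ι m⁻¹ ∙ ι m ≡ 𝟙
      m⁻¹m≡1 = trans (sym (ι-* m⁻¹ m)) (trans (cong ι (x⁻¹*x≡1 m≢0)) ι-1)
      m⁻¹n≡n/m : ι m⁻¹ ∙ ι n ≡ ι (n *ᴿ m⁻¹)
      m⁻¹n≡n/m = trans (sym (ι-* m⁻¹ n)) (cong ι (ℝ.*-comm m⁻¹ n))

mainTheorem10 : (ℝ : RealField) (𝒯 : RAlgebra ℝ) (_≲_ : RAlgebra.T 𝒯 → RAlgebra.T 𝒯 → Set) →
                IsPlausible 𝒯 _≲_ →
                (X C D : RAlgebra.T 𝒯) → RAlgebra.IsEvent 𝒯 C → RAlgebra.IsEvent 𝒯 D →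
                (num den q : ℝ̄ ℝ) →
                IsCondExp 𝒯 _≲_ (RAlgebra._∙_ 𝒯 X C) D num →
                IsCondExp 𝒯 _≲_ X (RAlgebra._∙_ 𝒯 C D) den →
                IsQuot ℝ num den q →
                IsCondExp 𝒯 _≲_ C D q
mainTheorem10 ℝ 𝒯 _≲_ plausible X C D C-event D-event _ _ _ = quotient-rule
  where
  open RAlgebra 𝒯 using (_∙_; -_)
  open RealFieldProperties ℝ using (-ℝ̄_)
  open RAlgebraProperties 𝒯 using (-‿distribˡ-*)
  open PlausiblePreorderProperties plausible using (E[_∣_]≡_; condExp-neg)
  open QuotientRule plausible C-event D-event

  neg-numerator : ∀ v → E[ X ∙ C ∣ D ]≡ v → E[ (- X) ∙ C ∣ D ]≡ (-ℝ̄ v)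
  neg-numerator v E = subst (λ Z → E[ Z ∣ D ]≡ (-ℝ̄ v)) (-‿distribˡ-* X C) (condExp-neg v E)

  quotient-rule : ∀ {num den q} → E[ X ∙ C ∣ D ]≡ num → E[ X ∣ C ∙ D ]≡ den → IsQuot ℝ num den q → E[ C ∣ D ]≡ q
  quotient-rule N M (real/real n m m≢0) = finite-quotient X N M m≢0
  quotient-rule N M (real/+∞ _)         = +∞-denominator⇒zero X N M
  quotient-rule N M (real/-∞ n)         = +∞-denominator⇒zero (- X) (neg-numerator (fin n) N) (condExp-neg -∞ M)
  quotient-rule N M (+∞/pos _ _)        = ⊥-elim (+∞-numerator-impossible X N M)
  quotient-rule N M (+∞/neg _ _)        = ⊥-elim (+∞-numerator-impossible X N M)
  quotient-rule N M (-∞/pos m _)        = ⊥-elim (+∞-numerator-impossible (- X) (neg-numerator -∞ N) (condExp-neg (fin m) M))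
  quotient-rule N M (-∞/neg m _)        = ⊥-elim (+∞-numerator-impossible (- X) (neg-numerator -∞ N) (condExp-neg (fin m) M))
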